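{- On $\textsf{Triangle}(8)$, the peg solitaire problem with starting vacancy c5 and finishing location a1 has a solution consisting of 15 moves whose last move is an 18-sweep (a sweep of the geometrically maximal length on this board).
   Context: The board $\textsf{Triangle}(n)$ has the holes $(r,k)$ with integers $1\le k\le r\le n$ (row $r$ from the top, position $k$ from the left in the row); hole $(r,k)$ is written as the $k$-th letter of the alphabet followed by $r$, so a1 is the top corner and c5 $=(5,3)$. The six directions are $d\in\{(0,\pm1),(\pm1,0),(1,1),(-1,-1)\}$. A jump: if $h,h+d,h+2d$ are on the board, $h$ and $h+d$ hold pegs and $h+2d$ is empty, the peg at $h$ moves to $h+2d$ and the peg at $h+d$ is removed. A peg solitaire problem with starting vacancy $s$ and finishing location $f$: starting with pegs in every hole except $s$, perform jumps until a single peg remains, at $f$. A move is a maximal block of consecutive jumps made by the same peg; a move consisting of $i$ jumps is an $i$-sweep. -}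

module Defs where

open import Data.Bool using (Bool; true; false; if_then_else_; _∧_; _∨_; not)
open import Data.Integer using (ℤ; +_; _+_; _≤_)
import Data.Integer as ℤ
open import Data.Nat using (ℕ; suc)
open import Data.List using (List; []; _∷_; length; last)
open import Data.Product using (_×_; _,_; proj₁; proj₂; Σ)
open import Data.Maybe using (Maybe; just)
open import Data.Unit using (⊤)
open import Relation.Nullary.Decidable using (⌊_⌋)
open import Relation.Binary.PropositionalEquality using (_≡_)

-- A hole (r , k): row r from the top, position k from the left.
Hole : Set
Hole = ℤ × ℤ

OnBoard : ℕ → Hole → Set
OnBoard n (r , k) = (+ 1 ≤ k) × (k ≤ r) × (r ≤ + n)

_==_ : Hole → Hole → Bool
(r , k) == (r' , k') = ⌊ r ℤ.≟ r' ⌋ ∧ ⌊ k ℤ.≟ k' ⌋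

data Dir : Set where
  E W S N SE NW : Dir

vec : Dir → Hole
vec E  = (+ 0 , + 1)
vec W  = (+ 0 , ℤ.- (+ 1))
vec S  = (+ 1 , + 0)
vec N  = (ℤ.- (+ 1) , + 0)
vec SE = (+ 1 , + 1)
vec NW = (ℤ.- (+ 1) , ℤ.- (+ 1))

_⊕_ : Hole → Hole → Hole
(a , b) ⊕ (c , d) = (a + c , b + d)

Jump : Set
Jump = Hole × Dir

start over land : Jump → Hole
start (h , d) = h
over  (h , d) = h ⊕ vec d
land  (h , d) = (h ⊕ vec d) ⊕ vec d

-- A configuration: which holes contain pegs (only on-board holes matter).
Config : Set
Config = Hole → Bool

Legal : ℕ → Config → Jump → Set
Legal n c j = OnBoard n (start j) × OnBoard n (over j) × OnBoard n (land j)
            × c (start j) ≡ true × c (over j) ≡ true × c (land j) ≡ false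

apply : Config → Jump → Config
apply c j p =
  if (p == start j) ∨ (p == over j) then false
  else if p == land j then true
  else c p

run : Config → List Jump → Config
run c [] = c
run c (j ∷ js) = run (apply c j) js

ValidSeq : ℕ → Config → List Jump → Set
ValidSeq n c [] = ⊤
ValidSeq n c (j ∷ js) = Legal n c j × ValidSeq n (apply c j) js

startConfig : Hole → Config
startConfig s p = not (p == s)

Solution : ℕ → Hole → Hole → List Jump → Set
Solution n s f js =
  ValidSeq n (startConfig s) js
  × ((p : Hole) → OnBoard n p → run (startConfig s) js p ≡ (p == f))

-- Decomposition into moves: maximal blocks of consecutive jumps by the same
-- peg (jump j' continues the move of j iff j' starts where j landed).
-- Returns the list of move lengths (an i-sweep has length i), in order.
private
  go : Jump → ℕ → List Jump → List ℕ
  go j k [] = k ∷ []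
  go j k (j' ∷ js) =
    if land j == start j' then go j' (suc k) js else k ∷ go j' 1 js

sweeps : List Jump → List ℕ
sweeps [] = []
sweeps (j ∷ js) = go j 1 js

c5 a1 : Hole
c5 = (+ 5 , + 3)
a1 = (+ 1 , + 1)

-- The theorem is witnessed by an explicit 34-jump solution. Legality of every jump
-- and the final position are decided by evaluation, the quantifier over holes being
-- reduced to a finite one over Fin (suc n) × Fin (suc n).
module Submission where

open import Defs
open import Data.Bool using (true; false)
import Data.Bool as Bool
open import Data.Fin using (Fin; toℕ; fromℕ<)
open import Data.Fin.Properties using (all?; toℕ-fromℕ<)
open import Data.Integer using (+_; -[1+_]; +≤+)
import Data.Integer as ℤ
open import Data.List using (List; []; _∷_; length; last)
open import Data.Maybe using (just)
open import Data.Nat using (ℕ; suc; s≤s)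
open import Data.Nat.Properties using (≤-trans)
open import Data.Product using (Σ; ∃₂; _×_; _,_)
open import Data.Unit using (tt)
open import Level using (Level)
open import Relation.Binary.PropositionalEquality using (_≡_; refl; sym; cong; cong₂)
open import Relation.Nullary using (Dec; yes)
open import Relation.Nullary.Decidable using (map′; toWitness; _×-dec_; _→-dec_)
open import Relation.Unary using (Pred; Decidable)

onBoard? : ∀ n p → Dec (OnBoard n p)
onBoard? n (r , k) = (+ 1 ℤ.≤? k) ×-dec (k ℤ.≤? r) ×-dec (r ℤ.≤? + n)

legal? : ∀ n c j → Dec (Legal n c j)
legal? n c j =
  onBoard? n (start j) ×-dec onBoard? n (over j) ×-dec onBoard? n (land j)
  ×-dec (c (start j) Bool.≟ true) ×-dec (c (over j) Bool.≟ true) ×-dec (c (land j) Bool.≟ false)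

validSeq? : ∀ n c js → Dec (ValidSeq n c js)
validSeq? n c []       = yes tt
validSeq? n c (j ∷ js) = legal? n c j ×-dec validSeq? n (apply c j) js

hole : ∀ {n} → Fin n → Fin n → Hole
hole r k = (+ toℕ r , + toℕ k)

onBoard⇒hole : ∀ {n p} → OnBoard n p → ∃₂ λ (r k : Fin (suc n)) → p ≡ hole r k
onBoard⇒hole {p = + r , + k} (_ , +≤+ k≤r , +≤+ r≤n) =
  fromℕ< (s≤s r≤n) , fromℕ< (s≤s (≤-trans k≤r r≤n)) ,
  cong₂ (λ a b → (+ a , + b)) (sym (toℕ-fromℕ< _)) (sym (toℕ-fromℕ< _))
onBoard⇒hole {p = -[1+ r ] , + k} (_ , () , _)
onBoard⇒hole {p = r , -[1+ k ]} (() , _)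

allOnBoard? : ∀ {ℓ : Level} n {P : Pred Hole ℓ} → Decidable P → Dec (∀ p → OnBoard n p → P p)
allOnBoard? n {P} P? =
  map′ fromHoles (λ onBoard⇒P r k → onBoard⇒P (hole r k))
       (all? λ r → all? λ k → onBoard? n (hole r k) →-dec P? (hole r k))
  where
  fromHoles : (∀ r k → OnBoard n (hole r k) → P (hole r k)) → ∀ p → OnBoard n p → P p
  fromHoles atHoles p onBoard with onBoard⇒hole onBoard
  ... | r , k , refl = atHoles r k onBoard

solution? : ∀ n s f js → Dec (Solution n s f js)
solution? n s f js =
  validSeq? n (startConfig s) js
  ×-dec allOnBoard? n (λ p → run (startConfig s) js p Bool.≟ (p == f))

-- Jumps are grouped into moves; the last five lines form the 18-sweep of the peg starting at a1.
c5⇝a1 : List Jump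
c5⇝a1 =
  ((+ 3 , + 1) , SE) ∷
  ((+ 4 , + 4) , W) ∷
  ((+ 4 , + 1) , E) ∷
  ((+ 6 , + 1) , N) ∷
  ((+ 6 , + 4) , NW) ∷
  ((+ 3 , + 3) , S) ∷
  ((+ 6 , + 3) , N) ∷
  ((+ 6 , + 6) , NW) ∷
  ((+ 8 , + 1) , N) ∷
  ((+ 8 , + 3) , N) ∷
  ((+ 8 , + 5) , W) ∷
  ((+ 8 , + 7) , W) ∷
  ((+ 8 , + 2) , E) ∷ ((+ 8 , + 4) , E) ∷ ((+ 8 , + 6) , NW) ∷
  ((+ 8 , + 8) , NW) ∷
  ((+ 1 , + 1) , S) ∷ ((+ 3 , + 1) , SE) ∷ ((+ 5 , + 3) , N) ∷ ((+ 3 , + 3) , W) ∷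
    ((+ 3 , + 1) , S) ∷ ((+ 5 , + 1) , SE) ∷ ((+ 7 , + 3) , E) ∷ ((+ 7 , + 5) , NW) ∷
    ((+ 5 , + 3) , W) ∷ ((+ 5 , + 1) , S) ∷ ((+ 7 , + 1) , E) ∷ ((+ 7 , + 3) , N) ∷
    ((+ 5 , + 3) , E) ∷ ((+ 5 , + 5) , S) ∷ ((+ 7 , + 5) , E) ∷ ((+ 7 , + 7) , NW) ∷
    ((+ 5 , + 5) , NW) ∷ ((+ 3 , + 3) , NW) ∷ []

c5⇝a1-solves : Solution 8 c5 a1 c5⇝a1
c5⇝a1-solves = toWitness {a? = solution? 8 c5 a1 c5⇝a1} tt

c5⇝a1-sweeps : sweeps c5⇝a1 ≡ 1 ∷ 1 ∷ 1 ∷ 1 ∷ 1 ∷ 1 ∷ 1 ∷ 1 ∷ 1 ∷ 1 ∷ 1 ∷ 1 ∷ 3 ∷ 1 ∷ 18 ∷ []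
c5⇝a1-sweeps = refl

mainTheorem5 : Σ (List Jump) (λ js → Solution 8 c5 a1 js
                 × length (sweeps js) ≡ 15 × last (sweeps js) ≡ just 18)
mainTheorem5 = c5⇝a1 , c5⇝a1-solves , cong length c5⇝a1-sweeps , cong last c5⇝a1-sweeps
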